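{- Let $k \geq 2$. For all finite simple graphs $G$ and $H$: if the $k$-WL distinguishes $G$ and $H$, then the $\delta$-$k$-WL also distinguishes $G$ and $H$. In the paper's notation, $\delta\text{ - }k\text{ -WL} \sqsubseteq k\text{ -WL}$.
   Context: Graphs are finite, simple and undirected. For a vertex $u$, $\delta(u)$ denotes its set of neighbours. For a tuple $\vec v=(v_1,\dots,v_k)\in V(G)^k$, a vertex $w$ and $j\in[k]$, let $\phi_j(\vec v,w)=(v_1,\dots,v_{j-1},w,v_{j+1},\dots,v_k)$. Initial colouring $C_0$ (common to all algorithms below): two tuples $\vec v\in V(G)^k$ and $\vec w\in V(H)^k$ (possibly $G=H$) receive the same colour iff the map $v_i\mapsto w_i$ is an isomorphism of the induced subgraphs whose vertices are marked by their indices. Equivalently, for all $i,j\in[k]$: $v_i=v_j \iff w_i=w_j$, and $\{v_i,v_j\}\in E(G) \iff \{w_i,w_j\}\in E(H)$. Colours are formal objects (nested tuples and multisets), so they can be compared across graphs. $k$-WL: set $C^k_{i+1}(\vec v)=(C^k_i(\vec v),M_i(\vec v))$, where $M_i(\vec v)$ is the multiset $\{\!\!\{(C^k_i(\phi_1(\vec v,w)),\dots,C^k_i(\phi_k(\vec v,w))) \mid w\in V(G)\}\!\!\}$. $\delta$-$k$-WL: set $C^{k,\delta,\bar\delta}_0=C_0$ and $C^{k,\delta,\bar\delta}_{i+1}(\vec v)=(C^{k,\delta,\bar\delta}_i(\vec v),M^{\delta,\bar\delta}_i(\vec v))$. Here $M^{\delta,\bar\delta}_i(\vec v)$ is the multiset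 over $w\in V(G)$ of the $k$-tuple $\big((C^{k,\delta,\bar\delta}_i(\phi_1(\vec v,w)),1_\delta(v_1,w)),\dots,(C^{k,\delta,\bar\delta}_i(\phi_k(\vec v,w)),1_\delta(v_k,w))\big)$, with $1_\delta(u,w)=\mathrm{L}$ if $w\in\delta(u)$ and $\mathrm{G}$ otherwise. Distinguishing: an algorithm is run in parallel on $G$ and $H$ until the colouring is stable on $V(G)^k\cup V(H)^k$, meaning $C_i(\vec v)=C_i(\vec w)\iff C_{i+1}(\vec v)=C_{i+1}(\vec w)$ for all tuples $\vec v,\vec w$. Call the resulting colouring $C_\infty$. The algorithm distinguishes $G$ and $H$ if some colour $c$ satisfies $|\{\vec v\in V(G)^k: C_\infty(\vec v)=c\}|\neq|\{\vec w\in V(H)^k: C_\infty(\vec w)=c\}|$. $A_1\sqsubseteq A_2$ means $A_1$ distinguishes every pair of graphs that $A_2$ distinguishes. -}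

module Defs where

open import Data.Nat using (ℕ; zero; suc)
open import Data.Bool using (Bool; true; false; if_then_else_)
open import Data.Fin using (Fin; _≟_)
open import Data.Product using (Σ; _×_)
open import Relation.Nullary using (¬_; yes; no)
open import Relation.Binary.PropositionalEquality using (_≡_)
open import Function.Bundles using (_↔_; _⇔_; Inverse)

record Graph : Set where
  field
    n        : ℕ
    adj      : Fin n → Fin n → Bool
    adj-sym  : ∀ u v → adj u v ≡ adj v u
    adj-irr  : ∀ u → adj u u ≡ false
open Graph public

Tup : ℕ → Graph → Set
Tup k G = Fin k → Fin (n G)

φ : ∀ {k} {A : Set} → Fin k → (Fin k → A) → A → (Fin k → A)
φ j v w i with i ≟ j
... | yes _ = w
... | no  _ = v i

SameC0 : ∀ {k} (G H : Graph) → Tup k G → Tup k H → Set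
SameC0 {k} G H v w =
  (∀ i j → (v i ≡ v j) ⇔ (w i ≡ w j)) ×
  (∀ i j → adj G (v i) (v j) ≡ adj H (w i) (w j))

-- A "colouring equality family": for each round i, when do two k-tuples
-- (of possibly different graphs) receive the same colour.
ColourEq : ℕ → Set₁
ColourEq k = ℕ → (G H : Graph) → Tup k G → Tup k H → Set

-- k-WL: C_{i+1}(v) = C_{i+1}(w) iff C_i(v) = C_i(w) and the multisets
-- {{ (C_i(φ_1(v,u)),…,C_i(φ_k(v,u))) | u }} coincide, i.e. there is a
-- bijection π between the vertex sets matching them up componentwise.
kWL : (k : ℕ) → ColourEq k
kWL k zero G H v w = SameC0 G H v w
kWL k (suc i) G H v w =
  kWL k i G H v w ×
  Σ (Fin (n G) ↔ Fin (n H)) λ π →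
    ∀ (u : Fin (n G)) (j : Fin k) →
      kWL k i G H (φ j v u) (φ j w (Inverse.to π u))

-- δ-k-WL: as k-WL, but each component additionally records whether
-- u is a neighbour of v_j (label L) or not (label G).
δkWL : (k : ℕ) → ColourEq k
δkWL k zero G H v w = SameC0 G H v w
δkWL k (suc i) G H v w =
  δkWL k i G H v w ×
  Σ (Fin (n G) ↔ Fin (n H)) λ π →
    ∀ (u : Fin (n G)) (j : Fin k) →
      δkWL k i G H (φ j v u) (φ j w (Inverse.to π u)) ×
      (adj G (v j) u ≡ adj H (w j) (Inverse.to π u))

pick : Bool → Graph → Graph → Graph
pick b G H = if b then G else H

-- The colouring at round i is stable on V(G)^k ∪ V(H)^k
Stable : ∀ {k} → ColourEq k → Graph → Graph → ℕ → Set
Stable {k} C G H i =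
  ∀ (a b : Bool) (x : Tup k (pick a G H)) (y : Tup k (pick b G H)) →
    C i (pick a G H) (pick b G H) x y ⇔ C (suc i) (pick a G H) (pick b G H) x y

-- Colour-class counts differ for some colour, i.e. the multisets of
-- colours of V(G)^k and V(H)^k differ: there is no colour-preserving
-- bijection between V(G)^k and V(H)^k.
CountsDiffer : ∀ {k} → ColourEq k → Graph → Graph → ℕ → Set
CountsDiffer {k} C G H i =
  ¬ (Σ (Tup k G ↔ Tup k H) λ σ → ∀ (v : Tup k G) → C i G H v (Inverse.to σ v))

Distinguishes : ∀ {k} → ColourEq k → Graph → Graph → Set
Distinguishes C G H = Σ ℕ λ i → Stable C G H i × CountsDiffer C G H i

module Submission where

-- For k ≥ 2 the δ-k-WL colouring and the k-WL colouring coincide in every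
-- round, so δ-k-WL distinguishes exactly the same pairs of graphs as k-WL.
--
-- The only extra information δ-k-WL records in round i+1 is whether the new
-- vertex u is adjacent to v_j.  But since k ≥ 2 there is an index j' ≠ j, and
-- the tuple φ_{j'}(v,u) contains both v_j (at position j) and u (at position
-- j').  Its round-i colour refines its atomic type C_0, which records the
-- adjacency of these two entries.  So whenever the k-WL condition matches
-- the tuples φ_{j'}(v,u) and φ_{j'}(w,π u) for all j', the neighbourhood
-- labels of u and π u agree automatically.

open import Defs
open import Data.Nat using (ℕ; _≤_; zero; suc; s≤s)
open import Data.Fin using (Fin; _≟_) renaming (zero to fzero; suc to fsuc)
open import Data.Empty using (⊥-elim)
open import Data.Product using (Σ; _,_; proj₁; proj₂)
open import Relation.Nullary using (¬_; yes; no)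
open import Relation.Binary.PropositionalEquality using (_≡_; refl; sym; cong₂; module ≡-Reasoning)
open import Function.Bundles using (_⇔_; Inverse; mk⇔; Equivalence)

φ-at : ∀ {k} {A : Set} (j : Fin k) (v : Fin k → A) (w : A) → φ j v w j ≡ w
φ-at j v w with j ≟ j
... | yes _  = refl
... | no j≢j = ⊥-elim (j≢j refl)

φ-elsewhere : ∀ {k} {A : Set} {i j : Fin k} (v : Fin k → A) (w : A) →
  ¬ i ≡ j → φ j v w i ≡ v i
φ-elsewhere {i = i} {j} v w i≢j with i ≟ j
... | yes i≡j = ⊥-elim (i≢j i≡j)
... | no _    = refl

another-index : ∀ {k} → 2 ≤ k → (j : Fin k) → Σ (Fin k) λ j' → ¬ j ≡ j'
another-index {suc (suc _)} _ fzero    = fsuc fzero , λ ()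
another-index {suc (suc _)} _ (fsuc _) = fzero , λ ()
another-index {suc zero} (s≤s ()) fzero

kWL-refines-C0 : ∀ {k} i {G H} {v : Tup k G} {w : Tup k H} →
  kWL k i G H v w → SameC0 G H v w
kWL-refines-C0 zero    same = same
kWL-refines-C0 (suc i) same = kWL-refines-C0 i (proj₁ same)

-- Use an index j' ≠ j: positions j and j' of
-- φ_{j'}(v,u) hold v_j and u.
neighbourhood-label-agrees : ∀ {k} → 2 ≤ k → ∀ {G H}
  (v : Tup k G) (w : Tup k H) (u : Fin (n G)) (u' : Fin (n H)) (j : Fin k) →
  (∀ j' → SameC0 G H (φ j' v u) (φ j' w u')) →
  adj G (v j) u ≡ adj H (w j) u'
neighbourhood-label-agrees k≥2 {G} {H} v w u u' j same
  with another-index k≥2 j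
... | j' , j≢j' = begin
  adj G (v j) u                      ≡⟨ sym (cong₂ (adj G) (φ-elsewhere v u j≢j') (φ-at j' v u)) ⟩
  adj G (φ j' v u j) (φ j' v u j')   ≡⟨ proj₂ (same j') j j' ⟩
  adj H (φ j' w u' j) (φ j' w u' j') ≡⟨ cong₂ (adj H) (φ-elsewhere w u' j≢j') (φ-at j' w u') ⟩
  adj H (w j) u'                     ∎
  where open ≡-Reasoning

kWL⇒δkWL : ∀ {k} → 2 ≤ k → ∀ i {G H} {v : Tup k G} {w : Tup k H} →
  kWL k i G H v w → δkWL k i G H v w
kWL⇒δkWL k≥2 zero    same = same
kWL⇒δkWL k≥2 (suc i) {G} {H} {v} {w} (same , π , match) =
  kWL⇒δkWL k≥2 i same , π , λ u j →
    kWL⇒δkWL k≥2 i (match u j) ,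
    neighbourhood-label-agrees k≥2 {G} {H} v w u (Inverse.to π u) j
      (λ j' → kWL-refines-C0 i (match u j'))

δkWL⇒kWL : ∀ {k} i {G H} {v : Tup k G} {w : Tup k H} →
  δkWL k i G H v w → kWL k i G H v w
δkWL⇒kWL zero    same = same
δkWL⇒kWL (suc i) (same , π , match) =
  δkWL⇒kWL i same , π , λ u j → δkWL⇒kWL i (proj₁ (match u j))

RoundwiseEquivalent : ∀ {k} → ColourEq k → ColourEq k → Set
RoundwiseEquivalent {k} C D =
  ∀ i G H (v : Tup k G) (w : Tup k H) → C i G H v w ⇔ D i G H v w

distinguishes-transfer : ∀ {k} {C D : ColourEq k} → RoundwiseEquivalent C D →
  ∀ {G H} → Distinguishes C G H → Distinguishes D G H
distinguishes-transfer {D = D} C⇔D {G} {H} (i , stable , differ) =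
  i , stable′ , differ′
  where
    open Equivalence

    stable′ : Stable D G H i
    stable′ a b x y = mk⇔
      (λ d → to   (C⇔D (suc i) _ _ x y) (to   (stable a b x y) (from (C⇔D i _ _ x y) d)))
      (λ d → to   (C⇔D i _ _ x y)       (from (stable a b x y) (from (C⇔D (suc i) _ _ x y) d)))

    differ′ : CountsDiffer D G H i
    differ′ (σ , preserves) =
      differ (σ , λ v → from (C⇔D i G H v (Inverse.to σ v)) (preserves v))

kWL≃δkWL : ∀ {k} → 2 ≤ k → RoundwiseEquivalent (kWL k) (δkWL k)
kWL≃δkWL k≥2 i G H v w = mk⇔ (kWL⇒δkWL k≥2 i) (δkWL⇒kWL i)

proposition1 : (k : ℕ) → 2 ≤ k → (G H : Graph) →
    Distinguishes (kWL k) G H → Distinguishes (δkWL k) G H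
proposition1 k k≥2 G H = distinguishes-transfer (kWL≃δkWL k≥2)
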